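{- Let $k\ge1$. For all $n\ge1$, $A_k(2n) = k A_k(2n-1) - A_k(n)$ and $A_k(2n+1) = k A_k(2n) - A_k(n+1)$.
   Context: $\Sigma_k=\{0,\ldots,k-1\}$. A palindrome is a word equal to its reverse, nontrivial if its length is at least $2$. $A_k(n)$ is the number of words of length $n$ over $\Sigma_k$ having no nontrivial palindromic prefix, i.e., no prefix of length $\ge 2$ (including the word itself) that is a palindrome. -}

module Defs where

open import Data.Nat using (ℕ; zero; suc; _≤_; _<_; _≤?_)
open import Data.Nat.Properties using (anyUpTo?)
open import Data.Fin using (Fin)
open import Data.Fin.Properties using (_≟_)
open import Data.List using (List; []; _∷_; reverse; take; length; filter; concatMap; map; allFin)
open import Data.List.Properties using (≡-dec)
open import Data.Product using (_×_; _,_; ∃)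
open import Relation.Nullary using (¬_; Dec)
open import Relation.Nullary.Decidable using (_×-dec_; ¬?)
open import Relation.Binary.PropositionalEquality using (_≡_)

-- Σ_k is represented by Fin k; words over Σ_k are lists of Fin k.

IsPalindrome : {k : ℕ} → List (Fin k) → Set
IsPalindrome w = w ≡ reverse w

isPalindrome? : {k : ℕ} → (w : List (Fin k)) → Dec (IsPalindrome w)
isPalindrome? w = ≡-dec _≟_ w (reverse w)

HasNontrivialPalPrefix : {k : ℕ} → List (Fin k) → Set
HasNontrivialPalPrefix w =
  ∃ λ i → i < suc (length w) × (2 ≤ i × IsPalindrome (take i w))

hasNontrivialPalPrefix? : {k : ℕ} → (w : List (Fin k)) → Dec (HasNontrivialPalPrefix w)
hasNontrivialPalPrefix? w =
  anyUpTo? (λ i → (2 ≤? i) ×-dec isPalindrome? (take i w)) (suc (length w))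

words : (k n : ℕ) → List (List (Fin k))
words k zero = [] ∷ []
words k (suc n) = concatMap (λ a → map (a ∷_) (words k n)) (allFin k)

A : (k n : ℕ) → ℕ
A k n = length (filter (λ w → ¬? (hasNontrivialPalPrefix? w)) (words k n))

-- Appending a letter a to a word w of length ≥ 1 without nontrivial palindromic prefix keeps
-- this property unless w ++ [a] is itself a palindrome, so k·A(m) = A(m+1) + P(m), where
-- P(m) = palindromicExtensions m counts the pairs (w, a) of such words w of length m with
-- w ++ [a] a palindrome. Such a palindrome of length 2n or 2n+1 is determined by its first
-- half h (of length n, resp. n+1), and w is palindromic-prefix-free exactly when h is: inside
-- the palindrome w ++ [a], a palindromic prefix of w longer than h folds onto a shorter one,
-- still of length ≥ 2. Hence P(2n−1) = A(n) and P(2n) = A(n+1).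

module Submission where

open import Defs
open import Data.Nat using (ℕ; zero; suc; _+_; _*_; _∸_; _≤_; _<_; s≤s; z≤n; _≤?_)
open import Data.Nat.Properties
  using (≤-trans; ≤-reflexive; <⇒≤; ≰⇒>; m<m+n; m≤n+m; m≤n⇒m⊓n≡m; m+n∸n≡m; +-mono-≤; +-monoˡ-≤;
         +-monoʳ-≤; +-cancelʳ-≤; +-assoc; +-comm; +-suc; +-identityʳ; +-0-commutativeMonoid;
         module ≤-Reasoning)
open import Data.Nat.Induction using (<-wellFounded)
open import Data.Integer using (+_; _-_; _⊖_) renaming (_*_ to _*ℤ_)
open import Data.Integer.Properties using (pos-*; m-n≡m⊖n; ⊖-≥)
open import Data.Bool using (Bool; true; false; _∧_; not; if_then_else_)
open import Data.Bool.Properties using (∧-comm; ∨-∧-booleanAlgebra)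
open import Algebra.Lattice.Properties.BooleanAlgebra ∨-∧-booleanAlgebra using (deMorgan₂)
open import Algebra.Properties.CommutativeMonoid.Sum +-0-commutativeMonoid
  using (sum; sum-syntax; sum-cong-≗; sum-replicate-zero; sum-remove; ∑-distrib-+; ∑-comm)
open import Data.Fin using (Fin; zero; suc; punchIn)
open import Data.Fin.Properties using (punchInᵢ≢i)
open import Data.List
  using (List; []; _∷_; _++_; _∷ʳ_; [_]; length; reverse; take; drop; map; filter; concatMap; tabulate;
         initLast; _∷ʳ′_)
open import Data.List.Properties
  using (length-++; length-++-≤ˡ; length-reverse; length-take; reverse-++; reverse-involutive;
         unfold-reverse; ++-assoc; ++-identityʳ; ++-cancelʳ; ∷-injectiveˡ; ∷-injectiveʳ; ∷ʳ-injectiveˡ;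
         ∷ʳ-++; take++drop≡id; filter-++)
open import Data.Product using (_×_; _,_; ∃; proj₁; proj₂)
open import Data.Sum using (_⊎_; inj₁; inj₂)
open import Data.Empty using (⊥-elim)
open import Function using (_∘_; id; _⇔_; mk⇔; module Equivalence)
open import Induction.WellFounded using (Acc; acc)
open import Relation.Unary using (Decidable)
open import Relation.Nullary using (Dec; yes; no; does; ¬?; _⊎-dec_)
open import Relation.Nullary.Decidable using (dec-true; dec-false; does-⇔)
import Relation.Nullary.Decidable as Dec
open import Relation.Binary.PropositionalEquality
  using (_≡_; _≢_; refl; sym; trans; cong; cong₂; subst; module ≡-Reasoning)

module _ {A : Set} where

  levi : (a b c d : List A) → a ++ b ≡ c ++ d → length c ≤ length a →
         ∃ λ m → a ≡ c ++ m × d ≡ m ++ b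
  levi a b [] d eq _ = a , refl , sym eq
  levi (x ∷ a) b (y ∷ c) d eq (s≤s c≤a) with refl ← ∷-injectiveˡ eq
    with m , a≡c++m , d≡m++b ← levi a b c d (∷-injectiveʳ eq) c≤a
    = m , cong (x ∷_) a≡c++m , d≡m++b

  take-length-++ : (u v : List A) → take (length u) (u ++ v) ≡ u
  take-length-++ []      v = refl
  take-length-++ (x ∷ u) v = cong (x ∷_) (take-length-++ u v)

  Palindrome : List A → Set
  Palindrome w = w ≡ reverse w

  palindrome-∷-∷ʳ⇔ : ∀ {a b q} → Palindrome (a ∷ q ∷ʳ b) ⇔ (a ≡ b × Palindrome q)
  palindrome-∷-∷ʳ⇔ {a} {b} {q} = mk⇔
    (λ pal → let eq = trans pal reverse-∷-∷ʳ in
      ∷-injectiveˡ eq , ∷ʳ-injectiveˡ q (reverse q) (∷-injectiveʳ eq))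
    (λ { (refl , pal) → trans (cong (λ r → a ∷ r ∷ʳ a) pal) (sym reverse-∷-∷ʳ) })
    where
    reverse-∷-∷ʳ : reverse (a ∷ q ∷ʳ b) ≡ b ∷ reverse q ∷ʳ a
    reverse-∷-∷ʳ = trans (unfold-reverse a (q ∷ʳ b)) (cong (_∷ʳ a) (reverse-++ q [ b ]))

  palindrome-++-reverse : ∀ {m} u → Palindrome m → Palindrome (u ++ m ++ reverse u)
  palindrome-++-reverse {m} u pal = sym (begin
    reverse (u ++ m ++ reverse u)
      ≡⟨ reverse-++ u (m ++ reverse u) ⟩
    reverse (m ++ reverse u) ++ reverse u
      ≡⟨ cong (_++ reverse u) (reverse-++ m (reverse u)) ⟩
    (reverse (reverse u) ++ reverse m) ++ reverse u
      ≡⟨ cong (λ x → (x ++ reverse m) ++ reverse u) (reverse-involutive u) ⟩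
    (u ++ reverse m) ++ reverse u
      ≡⟨ cong (λ x → (u ++ x) ++ reverse u) pal ⟨
    (u ++ m) ++ reverse u
      ≡⟨ ++-assoc u m (reverse u) ⟩
    u ++ m ++ reverse u
      ∎)
    where open ≡-Reasoning

  ++-++-reverse-∷ʳ : ∀ u m (a : A) → (u ++ m ++ reverse u) ∷ʳ a ≡ u ++ m ++ reverse (a ∷ u)
  ++-++-reverse-∷ʳ u m a = begin
    (u ++ m ++ reverse u) ++ [ a ]  ≡⟨ ++-assoc u (m ++ reverse u) [ a ] ⟩
    u ++ (m ++ reverse u) ++ [ a ]  ≡⟨ cong (u ++_) (++-assoc m (reverse u) [ a ]) ⟩
    u ++ m ++ reverse u ∷ʳ a        ≡⟨ cong (λ x → u ++ m ++ x) (unfold-reverse a u) ⟨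
    u ++ m ++ reverse (a ∷ u)       ∎
    where open ≡-Reasoning

  -- u ++ v = reverse v ++ u, so by Levi's lemma u = reverse v ++ x = x ++ v.
  palindrome-fold : ∀ {u v} → Palindrome (u ++ v) → Palindrome u → length v ≤ length u →
                    ∃ λ x → u ≡ x ++ v × Palindrome x
  palindrome-fold {u} {v} pal-uv pal-u v≤u =
    fold (levi u v (reverse v) u uv≡vᴿ++u (≤-trans (≤-reflexive (length-reverse v)) v≤u))
    where
    open ≡-Reasoning
    uv≡vᴿ++u : u ++ v ≡ reverse v ++ u
    uv≡vᴿ++u = begin
      u ++ v                 ≡⟨ pal-uv ⟩
      reverse (u ++ v)       ≡⟨ reverse-++ u v ⟩
      reverse v ++ reverse u ≡⟨ cong (reverse v ++_) (sym pal-u) ⟩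
      reverse v ++ u         ∎
    fold : (∃ λ x → u ≡ reverse v ++ x × u ≡ x ++ v) → ∃ λ x → u ≡ x ++ v × Palindrome x
    fold (x , u≡vᴿ++x , u≡x++v) = x , u≡x++v , sym (++-cancelʳ v (reverse x) x (begin
      reverse x ++ v                   ≡⟨ cong (reverse x ++_) (reverse-involutive v) ⟨
      reverse x ++ reverse (reverse v) ≡⟨ reverse-++ (reverse v) x ⟨
      reverse (reverse v ++ x)         ≡⟨ cong reverse u≡vᴿ++x ⟨
      reverse u                        ≡⟨ pal-u ⟨
      u                                ≡⟨ u≡x++v ⟩
      x ++ v                           ∎))

  data HasPalPrefix (w : List A) : Set where
    palPrefix : ∀ u v → 2 ≤ length u → Palindrome u → u ++ v ≡ w → HasPalPrefix w

  hasPalPrefix-++ : ∀ {u} v → HasPalPrefix u → HasPalPrefix (u ++ v)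
  hasPalPrefix-++ v (palPrefix x y 2≤x pal refl) = palPrefix x (y ++ v) 2≤x pal (sym (++-assoc x y v))

  hasPalPrefix-∷ʳ⇔ : ∀ {w a} → 1 ≤ length w →
                     HasPalPrefix (w ∷ʳ a) ⇔ (HasPalPrefix w ⊎ Palindrome (w ∷ʳ a))
  hasPalPrefix-∷ʳ⇔ {w} {a} 1≤w = mk⇔ to from
    where
    to : HasPalPrefix (w ∷ʳ a) → HasPalPrefix w ⊎ Palindrome (w ∷ʳ a)
    to (palPrefix u v 2≤u pal eq) with initLast v
    ... | []       = inj₂ (subst Palindrome (trans (sym (++-identityʳ u)) eq) pal)
    ... | v′ ∷ʳ′ c =
      inj₁ (palPrefix u v′ 2≤u pal (∷ʳ-injectiveˡ (u ++ v′) w (trans (++-assoc u v′ [ c ]) eq)))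
    from : HasPalPrefix w ⊎ Palindrome (w ∷ʳ a) → HasPalPrefix (w ∷ʳ a)
    from (inj₁ p)   = hasPalPrefix-++ [ a ] p
    from (inj₂ pal) =
      palPrefix (w ∷ʳ a) [] (subst (2 ≤_) (sym (length-++ w)) (+-monoˡ-≤ 1 1≤w)) pal (++-identityʳ _)

  -- A palindromic prefix u longer than h folds (palindrome-fold) onto a shorter one, still of
  -- length ≥ 2 because t is no longer than h.
  hasPalPrefix-firstHalf : ∀ {h t} → Palindrome (h ++ t) → length t ≤ length h →
    ∀ u v → u ++ v ≡ h ++ t → 1 ≤ length v → 2 ≤ length u → Palindrome u → HasPalPrefix h
  hasPalPrefix-firstHalf {h} {t} pal-ht t≤h u v eq 1≤v = go u v eq 1≤v (<-wellFounded (length u))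
    where
    go : ∀ u v → u ++ v ≡ h ++ t → 1 ≤ length v → Acc _<_ (length u) →
         2 ≤ length u → Palindrome u → HasPalPrefix h
    go u v eq 1≤v (acc rs) 2≤u pal-u with length u ≤? length h
    ... | yes u≤h with m , h≡u++m , _ ← levi h t u v (sym eq) u≤h
      = palPrefix u m 2≤u pal-u (sym h≡u++m)
    ... | no u≰h with levi u v h t eq (<⇒≤ (≰⇒> u≰h))
    ...   | [] , u≡h++[] , _ =
            ⊥-elim (u≰h (≤-reflexive (cong length (trans u≡h++[] (++-identityʳ h)))))
    ...   | m@(_ ∷ _) , u≡h++m , t≡m++v =
            shorten (palindrome-fold (subst Palindrome (sym eq) pal-ht) pal-u v≤u)
      where
      m+v≤h : length m + length v ≤ length h
      m+v≤h = ≤-trans (≤-reflexive (trans (sym (length-++ m)) (cong length (sym t≡m++v)))) t≤h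
      v≤u : length v ≤ length u
      v≤u = ≤-trans (≤-trans (m≤n+m (length v) (length m)) m+v≤h) (<⇒≤ (≰⇒> u≰h))
      shorten : (∃ λ x → u ≡ x ++ v × Palindrome x) → HasPalPrefix h
      shorten (x , u≡x++v , pal-x) =
        go x (v ++ v) x++vv≡h++t (≤-trans 1≤v (length-++-≤ˡ v)) (rs x<u) 2≤x pal-x
        where
        |x|+|v|≡|u| : length x + length v ≡ length u
        |x|+|v|≡|u| = trans (sym (length-++ x)) (cong length (sym u≡x++v))
        x++vv≡h++t : x ++ v ++ v ≡ h ++ t
        x++vv≡h++t = trans (sym (++-assoc x v v)) (trans (cong (_++ v) (sym u≡x++v)) eq)
        x<u : length x < length u
        x<u = subst (length x <_) |x|+|v|≡|u| (m<m+n (length x) 1≤v)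
        2≤x : 2 ≤ length x
        2≤x = +-cancelʳ-≤ (length v) 2 (length x) (begin
          2 + length v                     ≤⟨ +-monoˡ-≤ (length v) (+-mono-≤ {1} {length m} 1≤m 1≤m) ⟩
          length m + length m + length v   ≡⟨ +-assoc (length m) (length m) (length v) ⟩
          length m + (length m + length v) ≤⟨ +-monoʳ-≤ (length m) m+v≤h ⟩
          length m + length h              ≡⟨ +-comm (length m) (length h) ⟩
          length h + length m              ≡⟨ trans (sym (length-++ h)) (cong length (sym u≡h++m)) ⟩
          length u                         ≡⟨ |x|+|v|≡|u| ⟨
          length x + length v              ∎)
          where
          open ≤-Reasoning
          1≤m : 1 ≤ length m
          1≤m = s≤s z≤n

  hasPalPrefix-++-palindrome⇔ : ∀ {h t c} → Palindrome ((h ++ t) ∷ʳ c) → length t < length h →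
                                HasPalPrefix (h ++ t) ⇔ HasPalPrefix h
  hasPalPrefix-++-palindrome⇔ {h} {t} {c} pal t<h = mk⇔ to (hasPalPrefix-++ t)
    where
    to : HasPalPrefix (h ++ t) → HasPalPrefix h
    to (palPrefix u v 2≤u pal-u eq) =
      hasPalPrefix-firstHalf (subst Palindrome (++-assoc h t [ c ]) pal) t∷ʳc≤h
        u (v ∷ʳ c) (trans (sym (++-assoc u v [ c ])) (trans (cong (_∷ʳ c) eq) (++-assoc h t [ c ])))
        (subst (1 ≤_) (sym (length-++ v)) (m≤n+m 1 (length v))) 2≤u pal-u
      where
      t∷ʳc≤h : length (t ∷ʳ c) ≤ length h
      t∷ʳc≤h = subst (_≤ length h) (sym (trans (length-++ t) (+-comm (length t) 1))) t<h

length-filter-map : {A B : Set} {P : B → Set} (P? : Decidable P) (g : A → B) (xs : List A) →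
                    length (filter P? (map g xs)) ≡ length (filter (P? ∘ g) xs)
length-filter-map P? g []       = refl
length-filter-map P? g (x ∷ xs) with does (P? (g x))
... | true  = cong suc (length-filter-map P? g xs)
... | false = length-filter-map P? g xs

∑-cong : ∀ {k} {f g : Fin k → ℕ} → (∀ a → f a ≡ g a) → ∑[ a < k ] f a ≡ ∑[ a < k ] g a
∑-cong = sum-cong-≗

∑-const : ∀ k x → ∑[ a < k ] x ≡ k * x
∑-const zero    x = refl
∑-const (suc k) x = cong (_+_ x) (∑-const k x)

∑-δ : ∀ {k} (a : Fin k) (f : Fin k → ℕ) → (∀ b → b ≢ a → f b ≡ 0) → ∑[ b < k ] f b ≡ f a
∑-δ {suc k} a f f≡0 = begin
  sum f                      ≡⟨ sum-remove {i = a} f ⟩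
  f a + sum (f ∘ punchIn a)  ≡⟨ cong (_+_ (f a)) (trans (∑-cong f∘punchIn≗0) (sum-replicate-zero k)) ⟩
  f a + 0                    ≡⟨ +-identityʳ (f a) ⟩
  f a                        ∎
  where
  open ≡-Reasoning
  f∘punchIn≗0 : ∀ b → f (punchIn a b) ≡ 0
  f∘punchIn≗0 b = f≡0 (punchIn a b) (punchInᵢ≢i a b)

module _ {k : ℕ} where

  count : ℕ → (List (Fin k) → Bool) → ℕ
  count zero    f = if f [] then 1 else 0
  count (suc n) f = ∑[ a < k ] count n (λ w → f (a ∷ w))

  count-cong : ∀ n {f g : List (Fin k) → Bool} → (∀ w → length w ≡ n → f w ≡ g w) →
               count n f ≡ count n g
  count-cong zero    f≗g = cong (if_then 1 else 0) (f≗g [] refl)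
  count-cong (suc n) f≗g =
    ∑-cong {k} (λ a → count-cong n (λ w |w|≡n → f≗g (a ∷ w) (cong suc |w|≡n)))

  count-false : ∀ n → count n (λ _ → false) ≡ 0
  count-false zero    = refl
  count-false (suc n) = trans (∑-cong {k} (λ _ → count-false n)) (sum-replicate-zero k)

  count-split : ∀ n (f g : List (Fin k) → Bool) →
                count n f ≡ count n (λ w → f w ∧ g w) + count n (λ w → f w ∧ not (g w))
  count-split zero f g with f [] | g []
  ... | true  | true  = refl
  ... | true  | false = refl
  ... | false | _     = refl
  count-split (suc n) f g =
    trans (∑-cong {k} (λ a → count-split n (λ w → f (a ∷ w)) (λ w → g (a ∷ w))))
          (∑-distrib-+ {k} _ _)

  count-∷ʳ : ∀ n (f : List (Fin k) → Bool) →
             count (suc n) f ≡ ∑[ a < k ] count n (λ w → f (w ∷ʳ a))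
  count-∷ʳ zero    f = refl
  count-∷ʳ (suc n) f =
    trans (∑-cong {k} (λ a → count-∷ʳ n (λ w → f (a ∷ w)))) (∑-comm {k} {k} _)

  length-filter-concatMap : {P : List (Fin k) → Set} (P? : Decidable P) (ws : List (List (Fin k)))
    {m : ℕ} (g : Fin m → Fin k) →
    length (filter P? (concatMap (λ a → map (a ∷_) ws) (tabulate g)))
      ≡ ∑[ i < m ] length (filter (λ w → P? (g i ∷ w)) ws)
  length-filter-concatMap P? ws {zero}  g = refl
  length-filter-concatMap P? ws {suc m} g = begin
    length (filter P? (first ++ rest))
      ≡⟨ cong length (filter-++ P? first rest) ⟩
    length (filter P? first ++ filter P? rest)
      ≡⟨ length-++ (filter P? first) ⟩
    length (filter P? first) + length (filter P? rest)
      ≡⟨ cong₂ _+_ (length-filter-map P? (g zero ∷_) ws) (length-filter-concatMap P? ws (g ∘ suc)) ⟩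
    ∑[ i < suc m ] length (filter (λ w → P? (g i ∷ w)) ws)
      ∎
    where
    open ≡-Reasoning
    first rest : List (List (Fin k))
    first = map (g zero ∷_) ws
    rest  = concatMap (λ a → map (a ∷_) ws) (tabulate (g ∘ suc))

  length-filter-words : ∀ n {P : List (Fin k) → Set} (P? : Decidable P) →
                        length (filter P? (words k n)) ≡ count n (λ w → does (P? w))
  length-filter-words zero    P? with does (P? [])
  ... | true  = refl
  ... | false = refl
  length-filter-words (suc n) P? =
    trans (length-filter-concatMap P? (words k n) id)
          (∑-cong {k} (λ a → length-filter-words n (λ w → P? (a ∷ w))))

  hasNontrivialPalPrefix⇔ : (w : List (Fin k)) → HasNontrivialPalPrefix w ⇔ HasPalPrefix w
  hasNontrivialPalPrefix⇔ w = mk⇔ to from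
    where
    to : HasNontrivialPalPrefix w → HasPalPrefix w
    to (i , s≤s i≤w , 2≤i , pal) =
      palPrefix (take i w) (drop i w) (subst (2 ≤_) (sym |take|≡i) 2≤i) pal (take++drop≡id i w)
      where
      |take|≡i : length (take i w) ≡ i
      |take|≡i = trans (length-take i w) (m≤n⇒m⊓n≡m i≤w)
    from : HasPalPrefix w → HasNontrivialPalPrefix w
    from (palPrefix u v 2≤u pal refl) =
      length u , s≤s (length-++-≤ˡ u) , 2≤u , subst Palindrome (sym (take-length-++ u v)) pal

  hasPalPrefix? : (w : List (Fin k)) → Dec (HasPalPrefix w)
  hasPalPrefix? w = Dec.map (hasNontrivialPalPrefix⇔ w) (hasNontrivialPalPrefix? w)

  palindromeᵇ : List (Fin k) → Bool
  palindromeᵇ w = does (isPalindrome? w)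

  palPrefixFreeᵇ : List (Fin k) → Bool
  palPrefixFreeᵇ w = does (¬? (hasPalPrefix? w))

  A≡count : ∀ n → A k n ≡ count n palPrefixFreeᵇ
  A≡count n = length-filter-words n (λ w → ¬? (hasNontrivialPalPrefix? w))

  palindromeᵇ-∷-∷ʳ : ∀ a q → palindromeᵇ (a ∷ q ∷ʳ a) ≡ palindromeᵇ q
  palindromeᵇ-∷-∷ʳ a q = does-⇔
    (mk⇔ (proj₂ ∘ Equivalence.to palindrome-∷-∷ʳ⇔) (λ pal → Equivalence.from palindrome-∷-∷ʳ⇔ (refl , pal)))
    (isPalindrome? (a ∷ q ∷ʳ a))
    (isPalindrome? q)

  palindromeᵇ-∷-∷ʳ-≢ : ∀ {a b} q → b ≢ a → palindromeᵇ (b ∷ q ∷ʳ a) ≡ false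
  palindromeᵇ-∷-∷ʳ-≢ {a} {b} q b≢a =
    dec-false (isPalindrome? (b ∷ q ∷ʳ a)) (b≢a ∘ proj₁ ∘ Equivalence.to palindrome-∷-∷ʳ⇔)

  palPrefixFreeᵇ-∷ʳ : ∀ w a → 1 ≤ length w →
                      palPrefixFreeᵇ (w ∷ʳ a) ≡ palPrefixFreeᵇ w ∧ not (palindromeᵇ (w ∷ʳ a))
  palPrefixFreeᵇ-∷ʳ w a 1≤w = trans
    (cong not (does-⇔ (hasPalPrefix-∷ʳ⇔ 1≤w)
                      (hasPalPrefix? (w ∷ʳ a))
                      (hasPalPrefix? w ⊎-dec isPalindrome? (w ∷ʳ a))))
    (deMorgan₂ (does (hasPalPrefix? w)) (palindromeᵇ (w ∷ʳ a)))

  palPrefixFreeᵇ-++-palindrome : ∀ h t {c} → Palindrome ((h ++ t) ∷ʳ c) → length t < length h →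
                                 palPrefixFreeᵇ (h ++ t) ≡ palPrefixFreeᵇ h
  palPrefixFreeᵇ-++-palindrome h t pal t<h =
    cong not (does-⇔ (hasPalPrefix-++-palindrome⇔ pal t<h) (hasPalPrefix? (h ++ t)) (hasPalPrefix? h))

  count-palindrome-∷ʳ : ∀ ℓ a (R : List (Fin k) → Bool) →
    count (suc ℓ) (λ w → palindromeᵇ (w ∷ʳ a) ∧ R w) ≡ count ℓ (λ q → palindromeᵇ q ∧ R (a ∷ q))
  count-palindrome-∷ʳ ℓ a R = begin
    ∑[ b < k ] count ℓ (λ q → palindromeᵇ (b ∷ q ∷ʳ a) ∧ R (b ∷ q))
      ≡⟨ ∑-δ a _ (λ b b≢a → trans (count-cong ℓ (λ q _ → cong (_∧ R (b ∷ q)) (palindromeᵇ-∷-∷ʳ-≢ q b≢a)))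
                                  (count-false ℓ)) ⟩
    count ℓ (λ q → palindromeᵇ (a ∷ q ∷ʳ a) ∧ R (a ∷ q))
      ≡⟨ count-cong ℓ (λ q _ → cong (_∧ R (a ∷ q)) (palindromeᵇ-∷-∷ʳ a q)) ⟩
    count ℓ (λ q → palindromeᵇ q ∧ R (a ∷ q))
      ∎
    where open ≡-Reasoning

  count-palindromes-∷-∷ʳ : ∀ ℓ (R : List (Fin k) → Bool) →
    count (suc (suc ℓ)) (λ p → palindromeᵇ p ∧ R p)
      ≡ ∑[ a < k ] count ℓ (λ q → palindromeᵇ q ∧ R (a ∷ q ∷ʳ a))
  count-palindromes-∷-∷ʳ ℓ R =
    trans (count-∷ʳ (suc ℓ) (λ p → palindromeᵇ p ∧ R p))
          (∑-cong {k} (λ a → count-palindrome-∷ʳ ℓ a (λ w → R (w ∷ʳ a))))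

  count-palindromes-2n : ∀ n (R : List (Fin k) → Bool) →
    count (n + n) (λ p → palindromeᵇ p ∧ R p) ≡ count n (λ h → R (h ++ reverse h))
  count-palindromes-2n zero    R = refl
  count-palindromes-2n (suc n) R = begin
    count (suc n + suc n) (λ p → palindromeᵇ p ∧ R p)
      ≡⟨ cong (λ ℓ → count (suc ℓ) (λ p → palindromeᵇ p ∧ R p)) (+-suc n n) ⟩
    count (suc (suc (n + n))) (λ p → palindromeᵇ p ∧ R p)
      ≡⟨ count-palindromes-∷-∷ʳ (n + n) R ⟩
    ∑[ a < k ] count (n + n) (λ q → palindromeᵇ q ∧ R (a ∷ q ∷ʳ a))
      ≡⟨ ∑-cong {k} (λ a → count-palindromes-2n n (λ q → R (a ∷ q ∷ʳ a))) ⟩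
    ∑[ a < k ] count n (λ h → R (a ∷ (h ++ reverse h) ∷ʳ a))
      ≡⟨ ∑-cong {k} (λ a → count-cong n (λ h _ → cong (λ x → R (a ∷ x)) (++-++-reverse-∷ʳ h [] a))) ⟩
    count (suc n) (λ h → R (h ++ reverse h))
      ∎
    where open ≡-Reasoning

  count-palindromes-2n+1 : ∀ n (R : List (Fin k) → Bool) →
    count (suc (n + n)) (λ p → palindromeᵇ p ∧ R p) ≡ ∑[ c < k ] count n (λ u → R (u ++ c ∷ reverse u))
  count-palindromes-2n+1 zero    R =
    ∑-cong {k} (λ c → cong (λ b → if b ∧ R [ c ] then 1 else 0) (dec-true (isPalindrome? [ c ]) refl))
  count-palindromes-2n+1 (suc n) R = begin
    count (suc (suc n + suc n)) (λ p → palindromeᵇ p ∧ R p)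
      ≡⟨ cong (λ ℓ → count (suc (suc ℓ)) (λ p → palindromeᵇ p ∧ R p)) (+-suc n n) ⟩
    count (suc (suc (suc (n + n)))) (λ p → palindromeᵇ p ∧ R p)
      ≡⟨ count-palindromes-∷-∷ʳ (suc (n + n)) R ⟩
    ∑[ a < k ] count (suc (n + n)) (λ q → palindromeᵇ q ∧ R (a ∷ q ∷ʳ a))
      ≡⟨ ∑-cong {k} (λ a → count-palindromes-2n+1 n (λ q → R (a ∷ q ∷ʳ a))) ⟩
    ∑[ a < k ] ∑[ c < k ] count n (λ u → R (a ∷ (u ++ c ∷ reverse u) ∷ʳ a))
      ≡⟨ ∑-comm {k} {k} _ ⟩
    ∑[ c < k ] ∑[ a < k ] count n (λ u → R (a ∷ (u ++ c ∷ reverse u) ∷ʳ a))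
      ≡⟨ ∑-cong {k} (λ c → ∑-cong {k} (λ a → count-cong n (λ u _ →
           cong (λ x → R (a ∷ x)) (++-++-reverse-∷ʳ u [ c ] a)))) ⟩
    ∑[ c < k ] count (suc n) (λ u → R (u ++ c ∷ reverse u))
      ∎
    where open ≡-Reasoning

  palindromicExtensions : ℕ → ℕ
  palindromicExtensions m = ∑[ a < k ] count m (λ w → palPrefixFreeᵇ w ∧ palindromeᵇ (w ∷ʳ a))

  k*A≡A+palindromicExtensions : ∀ m → 1 ≤ m → k * A k m ≡ A k (suc m) + palindromicExtensions m
  k*A≡A+palindromicExtensions m 1≤m = begin
    k * A k m
      ≡⟨ cong (k *_) (A≡count m) ⟩
    k * count m palPrefixFreeᵇ
      ≡⟨ ∑-const k _ ⟨
    ∑[ a < k ] count m palPrefixFreeᵇ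
      ≡⟨ ∑-cong {k} (λ a → count-split m palPrefixFreeᵇ (palindromeᵇ ∘ (_∷ʳ a))) ⟩
    ∑[ a < k ] (closing a + nonClosing a)
      ≡⟨ ∑-distrib-+ closing nonClosing ⟩
    palindromicExtensions m + ∑[ a < k ] nonClosing a
      ≡⟨ +-comm (palindromicExtensions m) _ ⟩
    ∑[ a < k ] nonClosing a + palindromicExtensions m
      ≡⟨ cong (_+ palindromicExtensions m) nonClosing≡A ⟩
    A k (suc m) + palindromicExtensions m
      ∎
    where
    open ≡-Reasoning
    closing nonClosing : Fin k → ℕ
    closing    a = count m (λ w → palPrefixFreeᵇ w ∧ palindromeᵇ (w ∷ʳ a))
    nonClosing a = count m (λ w → palPrefixFreeᵇ w ∧ not (palindromeᵇ (w ∷ʳ a)))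
    nonClosing≡A : ∑[ a < k ] nonClosing a ≡ A k (suc m)
    nonClosing≡A = begin
      ∑[ a < k ] nonClosing a
        ≡⟨ ∑-cong {k} (λ a → count-cong m (λ w |w|≡m →
             sym (palPrefixFreeᵇ-∷ʳ w a (subst (1 ≤_) (sym |w|≡m) 1≤m)))) ⟩
      ∑[ a < k ] count m (λ w → palPrefixFreeᵇ (w ∷ʳ a)) ≡⟨ count-∷ʳ m palPrefixFreeᵇ ⟨
      count (suc m) palPrefixFreeᵇ                       ≡⟨ A≡count (suc m) ⟨
      A k (suc m)                                        ∎

  palindromicExtensions-suc : ∀ ℓ →
    palindromicExtensions (suc ℓ) ≡ ∑[ a < k ] count ℓ (λ q → palindromeᵇ q ∧ palPrefixFreeᵇ (a ∷ q))
  palindromicExtensions-suc ℓ = ∑-cong {k} (λ a →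
    trans (count-cong (suc ℓ) (λ w _ → ∧-comm (palPrefixFreeᵇ w) (palindromeᵇ (w ∷ʳ a))))
          (count-palindrome-∷ʳ ℓ a palPrefixFreeᵇ))

  palindromicExtensions-2n+1 : ∀ n → palindromicExtensions (suc (n + n)) ≡ A k (suc n)
  palindromicExtensions-2n+1 n = begin
    palindromicExtensions (suc (n + n))
      ≡⟨ palindromicExtensions-suc (n + n) ⟩
    ∑[ a < k ] count (n + n) (λ q → palindromeᵇ q ∧ palPrefixFreeᵇ (a ∷ q))
      ≡⟨ ∑-cong {k} (λ a → count-palindromes-2n n (λ q → palPrefixFreeᵇ (a ∷ q))) ⟩
    ∑[ a < k ] count n (λ h → palPrefixFreeᵇ (a ∷ h ++ reverse h))
      ≡⟨ ∑-cong {k} (λ a → count-cong n (λ h _ → palPrefixFreeᵇ-++-palindrome (a ∷ h) (reverse h)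
           (Equivalence.from palindrome-∷-∷ʳ⇔ (refl , palindrome-++-reverse h refl))
           (s≤s (≤-reflexive (length-reverse h))))) ⟩
    count (suc n) palPrefixFreeᵇ
      ≡⟨ A≡count (suc n) ⟨
    A k (suc n)
      ∎
    where open ≡-Reasoning

  palindromicExtensions-2n+2 : ∀ n → palindromicExtensions (suc (suc (n + n))) ≡ A k (suc (suc n))
  palindromicExtensions-2n+2 n = begin
    palindromicExtensions (suc (suc (n + n)))
      ≡⟨ palindromicExtensions-suc (suc (n + n)) ⟩
    ∑[ a < k ] count (suc (n + n)) (λ q → palindromeᵇ q ∧ palPrefixFreeᵇ (a ∷ q))
      ≡⟨ ∑-cong {k} (λ a → count-palindromes-2n+1 n (λ q → palPrefixFreeᵇ (a ∷ q))) ⟩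
    ∑[ a < k ] ∑[ c < k ] count n (λ u → palPrefixFreeᵇ (a ∷ u ++ c ∷ reverse u))
      ≡⟨ ∑-cong {k} (λ a → ∑-cong {k} (λ c → count-cong n (λ u _ → free-middle a c u))) ⟩
    ∑[ a < k ] ∑[ c < k ] count n (λ u → palPrefixFreeᵇ (a ∷ u ∷ʳ c))
      ≡⟨ ∑-cong {k} (λ a → count-∷ʳ n (λ w → palPrefixFreeᵇ (a ∷ w))) ⟨
    count (suc (suc n)) palPrefixFreeᵇ
      ≡⟨ A≡count (suc (suc n)) ⟨
    A k (suc (suc n))
      ∎
    where
    open ≡-Reasoning
    free-middle : ∀ a c u → palPrefixFreeᵇ (a ∷ u ++ c ∷ reverse u) ≡ palPrefixFreeᵇ (a ∷ u ∷ʳ c)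
    free-middle a c u = trans (cong (λ x → palPrefixFreeᵇ (a ∷ x)) (sym (∷ʳ-++ u c (reverse u))))
      (palPrefixFreeᵇ-++-palindrome (a ∷ u ∷ʳ c) (reverse u)
        (subst (λ x → Palindrome ((a ∷ x) ∷ʳ a)) (sym (∷ʳ-++ u c (reverse u)))
          (Equivalence.from palindrome-∷-∷ʳ⇔ (refl , palindrome-++-reverse u refl)))
        (s≤s (≤-trans (≤-reflexive (length-reverse u)) (length-++-≤ˡ u))))

  k*A[2n+1]≡A[2n+2]+A[n+1] : ∀ n → k * A k (suc (n + n)) ≡ A k (suc (suc (n + n))) + A k (suc n)
  k*A[2n+1]≡A[2n+2]+A[n+1] n = trans (k*A≡A+palindromicExtensions (suc (n + n)) (s≤s z≤n))
    (cong (_+_ (A k (suc (suc (n + n))))) (palindromicExtensions-2n+1 n))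

  k*A[2n+2]≡A[2n+3]+A[n+2] : ∀ n →
    k * A k (suc (suc (n + n))) ≡ A k (suc (suc (suc (n + n)))) + A k (suc (suc n))
  k*A[2n+2]≡A[2n+3]+A[n+2] n = trans (k*A≡A+palindromicExtensions (suc (suc (n + n))) (s≤s z≤n))
    (cong (_+_ (A k (suc (suc (suc (n + n)))))) (palindromicExtensions-2n+2 n))

k*x≡a+c⇒a≡k*x-c : ∀ k x {a c} → k * x ≡ a + c → + a ≡ + k *ℤ + x - + c
k*x≡a+c⇒a≡k*x-c k x {a} {c} k*x≡a+c = sym (begin
  + k *ℤ + x - + c   ≡⟨ cong (_- + c) (pos-* k x) ⟨
  + (k * x) - + c    ≡⟨ m-n≡m⊖n (k * x) c ⟩
  (k * x) ⊖ c        ≡⟨ cong (_⊖ c) k*x≡a+c ⟩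
  (a + c) ⊖ c        ≡⟨ ⊖-≥ (m≤n+m c a) ⟩
  + (a + c ∸ c)      ≡⟨ cong +_ (m+n∸n≡m a c) ⟩
  + a                ∎)
  where open ≡-Reasoning

proposition14 : (k : ℕ) → 1 ≤ k → (n : ℕ) → 1 ≤ n →
    (+ A k (2 * n) ≡ (+ k) *ℤ (+ A k (2 * n ∸ 1)) - (+ A k n))
    × (+ A k (suc (2 * n)) ≡ (+ k) *ℤ (+ A k (2 * n)) - (+ A k (suc n)))
proposition14 k _ (suc n) _ rewrite +-identityʳ n | +-suc n n =
    k*x≡a+c⇒a≡k*x-c k _ (k*A[2n+1]≡A[2n+2]+A[n+1] {k} n)
  , k*x≡a+c⇒a≡k*x-c k _ (k*A[2n+2]≡A[2n+3]+A[n+2] {k} n)
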